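{- Let $n\ge1$ and let $A$ be a combinatorial graph with at most $2n+2$ vertices (including $0$). Fix a color $\sigma\in\{1,-1\}$ and suppose the vertices of $A$ of color $\sigma$ different from $0$ span a subgroup of $\mathbb Z^m$ of rank $k$. Then either $A$ has exactly $k$ vertices of color $\sigma$ different from $0$, or there is a relation $\sum_c n_c c=0$ ($n_c\in\mathbb Z$) among these vertices with $\sum_c n_cC(c)\neq 0$ (an avoidable resonance).
   Context: Let $e_1,\dots,e_m$ be the standard basis of $\mathbb Z^m$, $\eta(a)=\sum_ia_i$. $G_2$ is the group of pairs $(a,\sigma)$, $a\in\mathbb Z^m$, $\sigma\in\{\pm1\}$, $\eta(a)=\sigma-1$ (color $\sigma=1$ black, $\sigma=-1$ red), with product $(b,\rho)(a,\sigma)=(b+\rho a,\rho\sigma)$ and identity $0=(0,1)$; identify $(a,\sigma)$ with $a$. $X=\{(e_i-e_j,1):i\ne j\}\cup\{(-e_i-e_j,-1):i\ne j\}$; the Cayley graph joins $g$ and $\ell g$, $\ell\in X$. A combinatorial graph is a finite connected subset of $G_2$ containing $0$ with all Cayley edges between its elements. For $g=(a,\sigma)$ define $C(g)=\frac\sigma2\big((\sum_ia_it_i)^2+\sum_ia_it_i^2\big)\in\mathbb Q[t_1,\dots,t_m]$. -}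

module Defs where

open import Data.Nat as ℕ using (ℕ; zero; suc)
open import Data.Integer as ℤ using (ℤ; +_; -_)
open import Data.Rational as ℚ using (ℚ)
open import Data.Fin as Fin using (Fin)
open import Data.Vec as Vec using (Vec; []; _∷_)
open import Data.List as List using (List; []; _∷_; length)
open import Data.List.Membership.Propositional using (_∈_)
open import Data.Product using (Σ; ∃; _×_; _,_; proj₁; proj₂)
open import Data.Sum using (_⊎_)
open import Data.Bool using (Bool; true; false; if_then_else_; _∧_; not)
open import Relation.Nullary using (¬_; does)
open import Relation.Binary.PropositionalEquality using (_≡_; _≢_)

data Color : Set where
  black red : Color

col : Color → ℤ
col black = + 1
col red   = - (+ 1)

_·c_ : Color → Color → Color
black ·c c = c
red   ·c black = red
red   ·c red   = black

_==c_ : Color → Color → Bool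
black ==c black = true
red   ==c red   = true
_     ==c _     = false

ℤ^ : ℕ → Set
ℤ^ m = Vec ℤ m

0v : ∀ {m} → ℤ^ m
0v = Vec.replicate _ (+ 0)

_+v_ : ∀ {m} → ℤ^ m → ℤ^ m → ℤ^ m
_+v_ = Vec.zipWith ℤ._+_

_*v_ : ∀ {m} → ℤ → ℤ^ m → ℤ^ m
n *v v = Vec.map (n ℤ.*_) v

e : ∀ {m} → Fin m → ℤ^ m
e i = Vec.updateAt (Vec.replicate _ (+ 0)) i (λ _ → + 1)

η : ∀ {m} → ℤ^ m → ℤ
η = Vec.foldr _ ℤ._+_ (+ 0)

isZeroVec : ∀ {m} → ℤ^ m → Bool
isZeroVec [] = true
isZeroVec (x ∷ v) = does (x ℤ.≟ + 0) ∧ isZeroVec v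

Elt : ℕ → Set
Elt m = ℤ^ m × Color

InG2 : ∀ {m} → Elt m → Set
InG2 (a , σ) = η a ≡ col σ ℤ.- + 1

_·_ : ∀ {m} → Elt m → Elt m → Elt m
(b , ρ) · (a , σ) = (b +v (col ρ *v a)) , (ρ ·c σ)

𝟘 : ∀ {m} → Elt m
𝟘 = 0v , black

data X {m : ℕ} : Elt m → Set where
  gen-black : (i j : Fin m) → i ≢ j → X ((e i +v ((- (+ 1)) *v e j)) , black)
  gen-red   : (i j : Fin m) → i ≢ j → X ((((- (+ 1)) *v e i) +v ((- (+ 1)) *v e j)) , red)

Adj : ∀ {m} → Elt m → Elt m → Set
Adj {m} g h = Σ (Elt m) λ ℓ → X ℓ × ((h ≡ ℓ · g) ⊎ (g ≡ ℓ · h))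

data Reach {m} (A : List (Elt m)) (g : Elt m) : Elt m → Set where
  here : Reach A g g
  step : ∀ {h h'} → Reach A g h → h' ∈ A → Adj h h' → Reach A g h'

open import Data.List.Relation.Unary.All using (All)
open import Data.List.Relation.Unary.Unique.Propositional using (Unique)

record CombGraph {m} (A : List (Elt m)) : Set where
  field
    inG2      : All InG2 A
    distinct  : Unique A
    hasZero   : 𝟘 ∈ A
    connected : ∀ {v} → v ∈ A → Reach A 𝟘 v

isColoredNonzero : ∀ {m} → Color → Elt m → Bool
isColoredNonzero σ (a , c) = (c ==c σ) ∧ not (isZeroVec a ∧ (c ==c black))

verts : ∀ {m} → Color → List (Elt m) → List (Elt m)
verts σ A = List.filterᵇ (isColoredNonzero σ) A

lc : ∀ {m} → List ℤ → List (ℤ^ m) → ℤ^ m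
lc (n ∷ ns) (v ∷ vs) = (n *v v) +v lc ns vs
lc _ _ = 0v

comb : ∀ {m} (vs : List (ℤ^ m)) → Vec ℤ (length vs) → ℤ^ m
comb vs ns = lc (Vec.toList ns) vs

Independent : ∀ {m} → List (ℤ^ m) → Set
Independent ws = ∀ (ns : Vec ℤ (length ws)) → comb ws ns ≡ 0v → ns ≡ Vec.replicate _ (+ 0)

InSpan : ∀ {m} → List (ℤ^ m) → ℤ^ m → Set
InSpan vs w = Σ (Vec ℤ (length vs)) λ ns → comb vs ns ≡ w

HasRank : ∀ {m} → List (ℤ^ m) → ℕ → Set
HasRank {m} vs k =
  (Σ (List (ℤ^ m)) λ ws → length ws ≡ k × All (InSpan vs) ws × Independent ws)
  × (∀ (ws : List (ℤ^ m)) → All (InSpan vs) ws → Independent ws → length ws ℕ.≤ k)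

-- The polynomial C(g) = σ/2 ((Σ a_i t_i)² + Σ a_i t_i²) ∈ ℚ[t_1..t_m].
-- It is homogeneous of degree 2; we represent such a polynomial by its
-- coefficients: coefficient of t_i t_j for i < j, of t_i² for i = j,
-- and 0 for i > j (each monomial is recorded exactly once).

QPoly : ℕ → Set
QPoly m = Fin m → Fin m → ℚ

ℤ→ℚ : ℤ → ℚ
ℤ→ℚ n = n ℚ./ 1

C : ∀ {m} → Elt m → QPoly m
C (a , σ) i j with Fin.compare i j
... | Fin.less _ _ = ℤ→ℚ (col σ ℤ.* (Vec.lookup a i ℤ.* Vec.lookup a j))
... | Fin.equal _ = (col σ ℤ.* (Vec.lookup a i ℤ.* Vec.lookup a i ℤ.+ Vec.lookup a i)) ℚ./ 2
... | Fin.greater _ _ = ℚ.0ℚ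

0P : ∀ {m} → QPoly m
0P _ _ = ℚ.0ℚ

_+P_ : ∀ {m} → QPoly m → QPoly m → QPoly m
(p +P q) i j = p i j ℚ.+ q i j

_*P_ : ∀ {m} → ℤ → QPoly m → QPoly m
(n *P p) i j = ℤ→ℚ n ℚ.* p i j

lcC : ∀ {m} → List ℤ → List (Elt m) → QPoly m
lcC (n ∷ ns) (c ∷ cs) = (n *P C c) +P lcC ns cs
lcC _ _ = 0P

NonzeroPoly : ∀ {m} → QPoly m → Set
NonzeroPoly {m} p = Σ (Fin m) λ i → Σ (Fin m) λ j → p i j ≢ ℚ.0ℚ

AvoidableResonance : ∀ {m} → List (Elt m) → Set
AvoidableResonance cs =
  Σ (Vec ℤ (length cs)) λ ns →
    lc (Vec.toList ns) (List.map proj₁ cs) ≡ 0v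
    × NonzeroPoly (lcC (Vec.toList ns) cs)

{-# OPTIONS --safe #-}
-- If the nonzero vertices of colour σ are ℤ-independent, their number is the rank k: by
-- Gaussian elimination no independent family in their span is longer. Otherwise take a
-- relation Σ n_c c = 0 with some n_x ≠ 0. The linear part of C(c) cancels in Σ n_c C(c), so
-- if there is no avoidable resonance then Σ n_c c_i c_j = 0 for all i, j, and consequently
-- (n_c (c_j − t))_c is again a relation for every coordinate j and integer t. Iterating with a
-- product P of such factors that vanishes at every vertex except x collapses the relation to
-- n_x P(x) x = 0, impossible since x ≠ 0.
module Submission where

open import Defs
open import Data.Nat as ℕ using (ℕ; zero; suc; z≤n; s≤s)
import Data.Nat.Properties as ℕ
open import Data.Integer as ℤ using (ℤ; +_; -_; _+_; _*_; _-_; 0ℤ; 1ℤ)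
import Data.Integer.Properties as ℤ
open import Data.Integer.Tactic.RingSolver using (solve-∀)
open import Data.Fin as Fin using (Fin; punchIn; punchOut)
import Data.Fin.Properties as Fin
open import Data.Vec as Vec using (Vec; []; _∷_; lookup; tabulate)
import Data.Vec.Properties as Vec
open import Data.List as List using (List; []; _∷_; length; map)
import Data.List.Properties as List
open import Data.List.Relation.Unary.All as All using (All; []; _∷_)
import Data.List.Relation.Unary.All.Properties as All
open import Data.List.Relation.Unary.Any as AnyM using (Any; here; there)
import Data.List.Relation.Unary.Any.Properties as Any
open import Algebra.Properties.AbelianGroup ℤ.+-0-abelianGroup using (inverseʳ-unique)
open import Data.List.Relation.Unary.AllPairs using (_∷_)
open import Data.List.Relation.Unary.Unique.Propositional using (Unique)
import Data.List.Relation.Unary.Unique.Propositional.Properties as Unique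
open import Data.List.Membership.Propositional using (_∈_)
open import Data.Rational as ℚ using (_/_)
import Data.Rational.Properties as ℚ
open import Data.Rational.Unnormalised as ℚᵘ using (mkℚᵘ; *≡*)
import Data.Rational.Unnormalised.Properties as ℚᵘ
import Data.Integer.GCD as ℤ
open import Data.Bool using (true; T; T?)
open import Data.Product using (Σ; ∃; ∃₂; _×_; _,_; proj₁; proj₂)
open import Data.Sum using (_⊎_; inj₁; inj₂)
open import Data.Empty using (⊥-elim)
open import Function using (_∘_)
open import Relation.Nullary using (¬_; yes; no)
open import Relation.Binary.Definitions using (tri<; tri≈; tri>)
open import Relation.Binary.PropositionalEquality

wsum : {A : Set} → List ℤ → List A → (A → ℤ) → ℤ
wsum (n ∷ ns) (x ∷ xs) f = n * f x + wsum ns xs f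
wsum _        _        _ = 0ℤ

reweight : {A : Set} → List ℤ → List A → (A → ℤ) → List ℤ
reweight (n ∷ ns) (x ∷ xs) g = g x * n ∷ reweight ns xs g
reweight _        _        _ = []

module _ {A : Set} where

  wsum-congᴬ : ∀ ns {xs : List A} {f g} → All (λ x → f x ≡ g x) xs → wsum ns xs f ≡ wsum ns xs g
  wsum-congᴬ []       _          = refl
  wsum-congᴬ (n ∷ ns) []         = refl
  wsum-congᴬ (n ∷ ns) (eq ∷ eqs) = cong₂ (λ a b → n * a + b) eq (wsum-congᴬ ns eqs)

  wsum-cong : ∀ ns (xs : List A) {f g} → (∀ x → f x ≡ g x) → wsum ns xs f ≡ wsum ns xs g
  wsum-cong ns xs f≗g = wsum-congᴬ ns (All.universal f≗g xs)

  wsum-vanishing : ∀ ns {xs : List A} {f} → All (λ x → f x ≡ 0ℤ) xs → wsum ns xs f ≡ 0ℤ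
  wsum-vanishing []       _              = refl
  wsum-vanishing (n ∷ ns) []             = refl
  wsum-vanishing (n ∷ ns) (fx≡0 ∷ rest) rewrite fx≡0 | wsum-vanishing ns rest | ℤ.*-zeroʳ n = refl

  wsum-zero-coeffs : ∀ {ns} (xs : List A) f → All (_≡ 0ℤ) ns → wsum ns xs f ≡ 0ℤ
  wsum-zero-coeffs xs       f []          = refl
  wsum-zero-coeffs []       f (_ ∷ _)     = refl
  wsum-zero-coeffs (x ∷ xs) f (refl ∷ zs) rewrite wsum-zero-coeffs xs f zs = refl

  wsum-+ : ∀ ns (xs : List A) f g → wsum ns xs (λ x → f x + g x) ≡ wsum ns xs f + wsum ns xs g
  wsum-+ []       xs       f g = refl
  wsum-+ (n ∷ ns) []       f g = refl
  wsum-+ (n ∷ ns) (x ∷ xs) f g rewrite wsum-+ ns xs f g = lemma n (f x) (g x) (wsum ns xs f) (wsum ns xs g)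
    where
    lemma : ∀ n a b c d → n * (a + b) + (c + d) ≡ (n * a + c) + (n * b + d)
    lemma = solve-∀

  wsum-*ˡ : ∀ ns (xs : List A) c f → wsum ns xs (λ x → c * f x) ≡ c * wsum ns xs f
  wsum-*ˡ []       xs       c f = sym (ℤ.*-zeroʳ c)
  wsum-*ˡ (n ∷ ns) []       c f = sym (ℤ.*-zeroʳ c)
  wsum-*ˡ (n ∷ ns) (x ∷ xs) c f rewrite wsum-*ˡ ns xs c f = lemma n c (f x) (wsum ns xs f)
    where
    lemma : ∀ n c a d → n * (c * a) + c * d ≡ c * (n * a + d)
    lemma = solve-∀

  wsum-linear : ∀ ns (xs : List A) f t g →
                wsum ns xs (λ x → f x - t * g x) ≡ wsum ns xs f - t * wsum ns xs g
  wsum-linear ns xs f t g = begin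
    wsum ns xs (λ x → f x - t * g x)
      ≡⟨ wsum-+ ns xs f _ ⟩
    wsum ns xs f + wsum ns xs (λ x → - (t * g x))
      ≡⟨ cong (_+_ (wsum ns xs f)) (wsum-cong ns xs (λ x → ℤ.neg-distribˡ-* t (g x))) ⟩
    wsum ns xs f + wsum ns xs (λ x → - t * g x)
      ≡⟨ cong (_+_ (wsum ns xs f)) (wsum-*ˡ ns xs (- t) g) ⟩
    wsum ns xs f + - t * wsum ns xs g
      ≡⟨ cong (_+_ (wsum ns xs f)) (sym (ℤ.neg-distribˡ-* t _)) ⟩
    wsum ns xs f - t * wsum ns xs g ∎
    where open ≡-Reasoning

  wsum-scale : ∀ c ns (xs : List A) f → wsum (map (c *_) ns) xs f ≡ c * wsum ns xs f
  wsum-scale c []       xs       f = sym (ℤ.*-zeroʳ c)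
  wsum-scale c (n ∷ ns) []       f = sym (ℤ.*-zeroʳ c)
  wsum-scale c (n ∷ ns) (x ∷ xs) f rewrite wsum-scale c ns xs f = lemma c n (f x) (wsum ns xs f)
    where
    lemma : ∀ c n a d → c * n * a + c * d ≡ c * (n * a + d)
    lemma = solve-∀

  wsum-reweight : ∀ ns (xs : List A) g f → wsum (reweight ns xs g) xs f ≡ wsum ns xs (λ x → g x * f x)
  wsum-reweight []       xs       g f = refl
  wsum-reweight (n ∷ ns) []       g f = refl
  wsum-reweight (n ∷ ns) (x ∷ xs) g f = cong₂ _+_ (lemma (g x) n (f x)) (wsum-reweight ns xs g f)
    where
    lemma : ∀ a n b → a * n * b ≡ n * (a * b)
    lemma = solve-∀

  length-reweight : ∀ ns (xs : List A) g → length ns ≡ length xs → length (reweight ns xs g) ≡ length xs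
  length-reweight []       []       g eq = refl
  length-reweight (n ∷ ns) (x ∷ xs) g eq = cong suc (length-reweight ns xs g (ℕ.suc-injective eq))

wsum-map : ∀ {A B : Set} ns (xs : List A) (g : A → B) f → wsum ns (map g xs) f ≡ wsum ns xs (f ∘ g)
wsum-map []       xs       g f = refl
wsum-map (n ∷ ns) []       g f = refl
wsum-map (n ∷ ns) (x ∷ xs) g f = cong (_+_ (n * f (g x))) (wsum-map ns xs g f)

lookup-ext : ∀ {A : Set} {d} (x y : Vec A d) → (∀ i → lookup x i ≡ lookup y i) → x ≡ y
lookup-ext x y eq = trans (sym (Vec.tabulate∘lookup x)) (trans (Vec.tabulate-cong eq) (Vec.tabulate∘lookup y))

lookup-0v : ∀ {d} (i : Fin d) → lookup (0v {d}) i ≡ 0ℤ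
lookup-0v i = Vec.lookup-replicate i 0ℤ

lookup-lc : ∀ {d} ns (vs : List (ℤ^ d)) i → lookup (lc ns vs) i ≡ wsum ns vs (λ v → lookup v i)
lookup-lc []       vs       i = lookup-0v i
lookup-lc (n ∷ ns) []       i = lookup-0v i
lookup-lc (n ∷ ns) (v ∷ vs) i =
  trans (Vec.lookup-zipWith _ i (n *v v) (lc ns vs))
        (cong₂ _+_ (Vec.lookup-map i (n *_) v) (lookup-lc ns vs i))

IsRelation : ∀ {d} → List ℤ → List (ℤ^ d) → Set
IsRelation {d} ns vs = ∀ (i : Fin d) → wsum ns vs (λ v → lookup v i) ≡ 0ℤ

IsRelation⇒lc≡0v : ∀ {d} ns (vs : List (ℤ^ d)) → IsRelation ns vs → lc ns vs ≡ 0v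
IsRelation⇒lc≡0v ns vs rel = lookup-ext _ _ λ i → trans (lookup-lc ns vs i) (trans (rel i) (sym (lookup-0v i)))

lc≡0v⇒IsRelation : ∀ {d} ns (vs : List (ℤ^ d)) → lc ns vs ≡ 0v → IsRelation ns vs
lc≡0v⇒IsRelation ns vs eq i = trans (sym (lookup-lc ns vs i)) (trans (cong (λ x → lookup x i) eq) (lookup-0v i))

LinIndependent : ∀ {d} → List (ℤ^ d) → Set
LinIndependent vs = ∀ ns → length ns ≡ length vs → IsRelation ns vs → All (_≡ 0ℤ) ns

LinDependent : ∀ {d} → List (ℤ^ d) → Set
LinDependent vs = Σ (List ℤ) λ ns → length ns ≡ length vs × IsRelation ns vs × Any (_≢ 0ℤ) ns

zero⊎nonzeroCoordinate : ∀ {d} (v : Vec ℤ d) → (∀ i → lookup v i ≡ 0ℤ) ⊎ ∃ λ j → lookup v j ≢ 0ℤ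
zero⊎nonzeroCoordinate v with Fin.all? (λ i → lookup v i ℤ.≟ 0ℤ)
... | yes allZero = inj₁ allZero
... | no ¬allZero = inj₂ (Fin.¬∀⟶∃¬ _ _ (λ i → lookup v i ℤ.≟ 0ℤ) ¬allZero)

differingCoordinate : ∀ {d} (x y : Vec ℤ d) → x ≢ y → ∃ λ j → lookup x j ≢ lookup y j
differingCoordinate x y x≢y with Fin.all? (λ i → lookup x i ℤ.≟ lookup y i)
... | yes eq  = ⊥-elim (x≢y (lookup-ext x y eq))
... | no ¬eq = Fin.¬∀⟶∃¬ _ _ (λ i → lookup x i ℤ.≟ lookup y i) ¬eq

*-≢0 : ∀ {i j} → i ≢ 0ℤ → j ≢ 0ℤ → i * j ≢ 0ℤ
*-≢0 {i} i≢0 j≢0 ij≡0 with ℤ.i*j≡0⇒i≡0∨j≡0 i ij≡0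
... | inj₁ i≡0 = i≢0 i≡0
... | inj₂ j≡0 = j≢0 j≡0

*-cancel-≢0 : ∀ {i j} → i ≢ 0ℤ → i * j ≡ 0ℤ → j ≡ 0ℤ
*-cancel-≢0 {i} i≢0 ij≡0 with ℤ.i*j≡0⇒i≡0∨j≡0 i ij≡0
... | inj₁ i≡0 = ⊥-elim (i≢0 i≡0)
... | inj₂ j≡0 = j≡0

zeroVector-dependent : ∀ {d} (v : Vec ℤ d) vs → (∀ i → lookup v i ≡ 0ℤ) → LinDependent (v ∷ vs)
zeroVector-dependent v vs allZero =
  1ℤ ∷ List.replicate (length vs) 0ℤ , cong suc (List.length-replicate (length vs)) , relation , here (λ ())
  where
  relation : IsRelation (1ℤ ∷ List.replicate (length vs) 0ℤ) (v ∷ vs)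
  relation i rewrite allZero i | wsum-zero-coeffs vs (λ u → lookup u i) (All.replicate⁺ (length vs) refl) = refl

module Elimination {d} (v : Vec ℤ (suc d)) (j : Fin (suc d)) (pivot≢0 : lookup v j ≢ 0ℤ) where

  pivot : ℤ
  pivot = lookup v j

  -- u ↦ v_j u − u_j v, whose j-th coordinate is zero and is dropped.
  eliminate : Vec ℤ (suc d) → Vec ℤ d
  eliminate u = tabulate (λ i → pivot * lookup u (punchIn j i) - lookup v (punchIn j i) * lookup u j)

  coordinateSum : List ℤ → List (Vec ℤ (suc d)) → Fin (suc d) → ℤ
  coordinateSum ns vs k = wsum ns vs (λ u → lookup u k)

  wsum-eliminate : ∀ ns vs i →
    wsum ns (map eliminate vs) (λ w → lookup w i)
      ≡ pivot * coordinateSum ns vs (punchIn j i) - lookup v (punchIn j i) * coordinateSum ns vs j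
  wsum-eliminate ns vs i = begin
    wsum ns (map eliminate vs) (λ w → lookup w i)
      ≡⟨ wsum-map ns vs eliminate _ ⟩
    wsum ns vs (λ u → lookup (eliminate u) i)
      ≡⟨ wsum-cong ns vs (λ u → Vec.lookup∘tabulate _ i) ⟩
    wsum ns vs (λ u → pivot * lookup u (punchIn j i) - lookup v (punchIn j i) * lookup u j)
      ≡⟨ wsum-linear ns vs (λ u → pivot * lookup u (punchIn j i)) (lookup v (punchIn j i)) (λ u → lookup u j) ⟩
    wsum ns vs (λ u → pivot * lookup u (punchIn j i)) - lookup v (punchIn j i) * coordinateSum ns vs j
      ≡⟨ cong (_- (lookup v (punchIn j i) * coordinateSum ns vs j)) (wsum-*ˡ ns vs pivot (λ u → lookup u (punchIn j i))) ⟩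
    pivot * coordinateSum ns vs (punchIn j i) - lookup v (punchIn j i) * coordinateSum ns vs j
      ∎
    where open ≡-Reasoning

  lift-dependence : ∀ vs → LinDependent (map eliminate vs) → LinDependent (v ∷ vs)
  lift-dependence vs (ms , len , rel , nonzero) =
    ns , cong suc (trans (List.length-map _ ms) (trans len (List.length-map eliminate vs))) ,
    relation , there (Any.map⁺ (AnyM.map (*-≢0 pivot≢0) nonzero))
    where
    Sⱼ : ℤ
    Sⱼ = coordinateSum ms vs j
    ns : List ℤ
    ns = - Sⱼ ∷ map (pivot *_) ms
    relation : IsRelation ns (v ∷ vs)
    relation k rewrite wsum-scale pivot ms vs (λ u → lookup u k) with k Fin.≟ j
    ... | yes refl = cancels pivot Sⱼ
      where
      cancels : ∀ p s → - s * p + p * s ≡ 0ℤ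
      cancels = solve-∀
    ... | no k≢j = begin
      - Sⱼ * lookup v k + pivot * coordinateSum ms vs k
        ≡⟨ rearrange (lookup v k) Sⱼ pivot _ ⟩
      pivot * coordinateSum ms vs k - lookup v k * Sⱼ
        ≡⟨ cong (λ k′ → pivot * coordinateSum ms vs k′ - lookup v k′ * Sⱼ) (sym (Fin.punchIn-punchOut j≢k)) ⟩
      pivot * coordinateSum ms vs (punchIn j i) - lookup v (punchIn j i) * Sⱼ
        ≡⟨ sym (wsum-eliminate ms vs i) ⟩
      wsum ms (map eliminate vs) (λ w → lookup w i)
        ≡⟨ rel i ⟩
      0ℤ ∎
      where
      open ≡-Reasoning
      j≢k : j ≢ k
      j≢k = k≢j ∘ sym
      i : Fin d
      i = punchOut j≢k
      rearrange : ∀ a s p t → - s * a + p * t ≡ p * t - a * s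
      rearrange = solve-∀

  lift-independence : ∀ vs → LinIndependent (map eliminate vs) → LinIndependent (v ∷ vs)
  lift-independence vs indep (n₀ ∷ ns) len rel = n₀≡0 ∷ ns≡0
    where
    Sₖ≡-n₀vₖ : ∀ k → coordinateSum ns vs k ≡ - (n₀ * lookup v k)
    Sₖ≡-n₀vₖ k = inverseʳ-unique (n₀ * lookup v k) _ (rel k)
    eliminated-relation : IsRelation ns (map eliminate vs)
    eliminated-relation i = begin
      wsum ns (map eliminate vs) (λ w → lookup w i)
        ≡⟨ wsum-eliminate ns vs i ⟩
      pivot * coordinateSum ns vs (punchIn j i) - lookup v (punchIn j i) * coordinateSum ns vs j
        ≡⟨ cong₂ (λ a b → pivot * a - lookup v (punchIn j i) * b) (Sₖ≡-n₀vₖ (punchIn j i)) (Sₖ≡-n₀vₖ j) ⟩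
      pivot * - (n₀ * lookup v (punchIn j i)) - lookup v (punchIn j i) * - (n₀ * pivot)
        ≡⟨ cancels pivot n₀ (lookup v (punchIn j i)) ⟩
      0ℤ ∎
      where
      open ≡-Reasoning
      cancels : ∀ p n a → p * - (n * a) - a * - (n * p) ≡ 0ℤ
      cancels = solve-∀
    ns≡0 : All (_≡ 0ℤ) ns
    ns≡0 = indep ns (trans (ℕ.suc-injective len) (sym (List.length-map eliminate vs))) eliminated-relation
    n₀pivot≡0 : n₀ * pivot ≡ 0ℤ
    n₀pivot≡0 = trans (sym (ℤ.+-identityʳ _))
                  (trans (cong (_+_ (n₀ * pivot)) (sym (wsum-zero-coeffs vs (λ u → lookup u j) ns≡0))) (rel j))
    n₀≡0 : n₀ ≡ 0ℤ
    n₀≡0 = *-cancel-≢0 pivot≢0 (trans (ℤ.*-comm pivot n₀) n₀pivot≡0)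

independent⊎dependent : ∀ d (vs : List (ℤ^ d)) → (LinIndependent vs × length vs ℕ.≤ d) ⊎ LinDependent vs
independent⊎dependent d [] = inj₁ (nil-independent , z≤n)
  where
  nil-independent : LinIndependent []
  nil-independent [] _ _ = []
independent⊎dependent d (v ∷ vs) with zero⊎nonzeroCoordinate v
... | inj₁ allZero = inj₂ (zeroVector-dependent v vs allZero)
independent⊎dependent zero    (v ∷ vs) | inj₂ (() , _)
independent⊎dependent (suc d) (v ∷ vs) | inj₂ (j , pivot≢0)
  with independent⊎dependent d (map (Elimination.eliminate v j pivot≢0) vs)
... | inj₁ (indep , len≤d) =
  inj₁ (lift-independence vs indep , s≤s (subst (ℕ._≤ d) (List.length-map eliminate vs) len≤d))
  where open Elimination v j pivot≢0
... | inj₂ dep = inj₂ (Elimination.lift-dependence v j pivot≢0 vs dep)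

toVec : ∀ {k} (xs : List ℤ) → length xs ≡ k → Vec ℤ k
toVec xs refl = Vec.fromList xs

toList-toVec : ∀ {k} (xs : List ℤ) (eq : length xs ≡ k) → Vec.toList (toVec xs eq) ≡ xs
toList-toVec xs refl = Vec.toList∘fromList xs

toList-replicate-allZero : ∀ k → All (_≡ 0ℤ) (Vec.toList (Vec.replicate k 0ℤ))
toList-replicate-allZero k = subst (All (_≡ 0ℤ)) (sym (Vec.toList-replicate k 0ℤ)) (All.replicate⁺ k refl)

allZero⇒≡replicate : ∀ {k} (xs : Vec ℤ k) → All (_≡ 0ℤ) (Vec.toList xs) → xs ≡ Vec.replicate k 0ℤ
allZero⇒≡replicate []       _           = refl
allZero⇒≡replicate (x ∷ xs) (refl ∷ zs) = cong (0ℤ ∷_) (allZero⇒≡replicate xs zs)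

LinIndependent⇒Independent : ∀ {d} (vs : List (ℤ^ d)) → LinIndependent vs → Independent vs
LinIndependent⇒Independent vs indep ns comb≡0 =
  allZero⇒≡replicate ns (indep (Vec.toList ns) (Vec.length-toList ns) (lc≡0v⇒IsRelation (Vec.toList ns) vs comb≡0))

Independent⇒¬LinDependent : ∀ {d} (vs : List (ℤ^ d)) → Independent vs → ¬ LinDependent vs
Independent⇒¬LinDependent vs indep (ns , len , rel , nonzero) = All.Any¬⇒¬All nonzero allZero
  where
  zeroVec : toVec ns len ≡ Vec.replicate (length vs) 0ℤ
  zeroVec = indep (toVec ns len) (trans (cong (λ xs → lc xs vs) (toList-toVec ns len)) (IsRelation⇒lc≡0v ns vs rel))
  allZero : All (_≡ 0ℤ) ns
  allZero = subst (All (_≡ 0ℤ)) (toList-toVec ns len)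
    (subst (All (_≡ 0ℤ) ∘ Vec.toList) (sym zeroVec) (toList-replicate-allZero (length vs)))

InSpan-self : ∀ {d} (vs : List (ℤ^ d)) → All (InSpan vs) vs
InSpan-self []       = []
InSpan-self (v ∷ vs) = (1ℤ ∷ Vec.replicate (length vs) 0ℤ , v-in-span) ∷ All.map shift (InSpan-self vs)
  where
  v-in-span : comb (v ∷ vs) (1ℤ ∷ Vec.replicate (length vs) 0ℤ) ≡ v
  v-in-span = lookup-ext _ _ λ i → begin
    lookup (comb (v ∷ vs) (1ℤ ∷ Vec.replicate (length vs) 0ℤ)) i
      ≡⟨ lookup-lc (1ℤ ∷ Vec.toList (Vec.replicate (length vs) 0ℤ)) (v ∷ vs) i ⟩
    1ℤ * lookup v i + wsum (Vec.toList (Vec.replicate (length vs) 0ℤ)) vs (λ u → lookup u i)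
      ≡⟨ cong (_+_ (1ℤ * lookup v i)) (wsum-zero-coeffs vs _ (toList-replicate-allZero (length vs))) ⟩
    1ℤ * lookup v i + 0ℤ
      ≡⟨ trans (ℤ.+-identityʳ _) (ℤ.*-identityˡ _) ⟩
    lookup v i ∎
    where open ≡-Reasoning
  shift : ∀ {w} → InSpan vs w → InSpan (v ∷ vs) w
  shift (M , refl) = 0ℤ ∷ M , lookup-ext _ _ λ i →
    trans (lookup-lc (0ℤ ∷ Vec.toList M) (v ∷ vs) i) (trans (ℤ.+-identityˡ _) (sym (lookup-lc (Vec.toList M) vs i)))

coefficientsOf : ∀ {d} {vs : List (ℤ^ d)} {ws} → All (InSpan vs) ws → List (Vec ℤ (length vs))
coefficientsOf []             = []
coefficientsOf ((M , _) ∷ ps) = M ∷ coefficientsOf ps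

length-coefficientsOf : ∀ {d} {vs : List (ℤ^ d)} {ws} (ps : All (InSpan vs) ws) → length (coefficientsOf ps) ≡ length ws
length-coefficientsOf []       = refl
length-coefficientsOf (_ ∷ ps) = cong suc (length-coefficientsOf ps)

wsum-coefficientsOf : ∀ {d} {vs : List (ℤ^ d)} {ws} xs (ps : All (InSpan vs) ws) f →
                      wsum xs ws f ≡ wsum xs (coefficientsOf ps) (f ∘ comb vs)
wsum-coefficientsOf []       ps                f = refl
wsum-coefficientsOf (x ∷ xs) []                f = refl
wsum-coefficientsOf (x ∷ xs) ((M , refl) ∷ ps) f = cong (_+_ (x * f _)) (wsum-coefficientsOf xs ps f)

wsum-nested-vanishing : ∀ {A : Set} (vs : List A) xs (Ms : List (Vec ℤ (length vs))) f →
                        (∀ q → wsum xs Ms (λ M → lookup M q) ≡ 0ℤ) →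
                        wsum xs Ms (λ M → wsum (Vec.toList M) vs f) ≡ 0ℤ
wsum-nested-vanishing []       xs Ms f _   =
  trans (wsum-cong xs Ms λ { [] → refl }) (wsum-vanishing xs (All.universal (λ _ → refl) Ms))
wsum-nested-vanishing (u ∷ vs) xs Ms f rel = begin
  wsum xs Ms (λ M → wsum (Vec.toList M) (u ∷ vs) f)
    ≡⟨ wsum-cong xs Ms (λ { (_ ∷ _) → refl }) ⟩
  wsum xs Ms (λ M → lookup M Fin.zero * f u + wsum (Vec.toList (Vec.tail M)) vs f)
    ≡⟨ wsum-+ xs Ms _ _ ⟩
  wsum xs Ms (λ M → lookup M Fin.zero * f u) + wsum xs Ms (λ M → wsum (Vec.toList (Vec.tail M)) vs f)
    ≡⟨ cong₂ _+_ head-vanishes tail-vanishes ⟩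
  0ℤ ∎
  where
  open ≡-Reasoning
  head-vanishes : wsum xs Ms (λ M → lookup M Fin.zero * f u) ≡ 0ℤ
  head-vanishes = begin
    wsum xs Ms (λ M → lookup M Fin.zero * f u) ≡⟨ wsum-cong xs Ms (λ M → ℤ.*-comm (lookup M Fin.zero) (f u)) ⟩
    wsum xs Ms (λ M → f u * lookup M Fin.zero) ≡⟨ wsum-*ˡ xs Ms (f u) _ ⟩
    f u * wsum xs Ms (λ M → lookup M Fin.zero) ≡⟨ cong (f u *_) (rel Fin.zero) ⟩
    f u * 0ℤ                                   ≡⟨ ℤ.*-zeroʳ (f u) ⟩
    0ℤ ∎
  tail-vanishes : wsum xs Ms (λ M → wsum (Vec.toList (Vec.tail M)) vs f) ≡ 0ℤ
  tail-vanishes = trans (sym (wsum-map xs Ms Vec.tail _)) (wsum-nested-vanishing vs xs (map Vec.tail Ms) f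
    λ q → trans (wsum-map xs Ms Vec.tail _) (trans (wsum-cong xs Ms (λ { (_ ∷ _) → refl })) (rel (Fin.suc q))))

IsRelation-coefficientsOf : ∀ {d} {vs : List (ℤ^ d)} {ws} xs (ps : All (InSpan vs) ws) →
                            IsRelation xs (coefficientsOf ps) → IsRelation xs ws
IsRelation-coefficientsOf {vs = vs} {ws} xs ps rel i = begin
  wsum xs ws (λ w → lookup w i)
    ≡⟨ wsum-coefficientsOf xs ps _ ⟩
  wsum xs (coefficientsOf ps) (λ M → lookup (comb vs M) i)
    ≡⟨ wsum-cong xs _ (λ M → lookup-lc (Vec.toList M) vs i) ⟩
  wsum xs (coefficientsOf ps) (λ M → wsum (Vec.toList M) vs (λ v → lookup v i))
    ≡⟨ wsum-nested-vanishing vs xs _ _ rel ⟩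
  0ℤ ∎
  where open ≡-Reasoning

rank≤length : ∀ {d} (vs : List (ℤ^ d)) ws → All (InSpan vs) ws → Independent ws → length ws ℕ.≤ length vs
rank≤length vs ws ps indep with independent⊎dependent (length vs) (coefficientsOf ps)
... | inj₁ (_ , len≤) = subst (ℕ._≤ length vs) (length-coefficientsOf ps) len≤
... | inj₂ (xs , len , rel , nonzero) = ⊥-elim (Independent⇒¬LinDependent ws indep
        (xs , trans len (length-coefficientsOf ps) , IsRelation-coefficientsOf xs ps rel , nonzero))

LinIndependent⇒length≡rank : ∀ {d} {vs : List (ℤ^ d)} {k} → LinIndependent vs → HasRank vs k → length vs ≡ k
LinIndependent⇒length≡rank {vs = vs} indep ((ws , refl , ps , indepWs) , maximal) =
  ℕ.≤-antisym (maximal vs (InSpan-self vs) (LinIndependent⇒Independent vs indep)) (rank≤length vs ws ps indepWs)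

fromℚᵘ-homo-+ : ∀ p q → ℚ.fromℚᵘ p ℚ.+ ℚ.fromℚᵘ q ≡ ℚ.fromℚᵘ (p ℚᵘ.+ q)
fromℚᵘ-homo-+ p q = ℚ.toℚᵘ-injective (ℚᵘ.≃-trans (ℚ.toℚᵘ-homo-+ (ℚ.fromℚᵘ p) (ℚ.fromℚᵘ q))
  (ℚᵘ.≃-trans (ℚᵘ.+-cong (ℚ.toℚᵘ-fromℚᵘ p) (ℚ.toℚᵘ-fromℚᵘ q)) (ℚᵘ.≃-sym (ℚ.toℚᵘ-fromℚᵘ (p ℚᵘ.+ q)))))

fromℚᵘ-homo-* : ∀ p q → ℚ.fromℚᵘ p ℚ.* ℚ.fromℚᵘ q ≡ ℚ.fromℚᵘ (p ℚᵘ.* q)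
fromℚᵘ-homo-* p q = ℚ.toℚᵘ-injective (ℚᵘ.≃-trans (ℚ.toℚᵘ-homo-* (ℚ.fromℚᵘ p) (ℚ.fromℚᵘ q))
  (ℚᵘ.≃-trans (ℚᵘ.*-cong (ℚ.toℚᵘ-fromℚᵘ p) (ℚ.toℚᵘ-fromℚᵘ q)) (ℚᵘ.≃-sym (ℚ.toℚᵘ-fromℚᵘ (p ℚᵘ.* q)))))

-- ℤ→ℚ n and x / 2 unfold to fromℚᵘ (mkℚᵘ n 0) and fromℚᵘ (mkℚᵘ x 1), so both identities are
-- computed in ℚᵘ, where equality is cross-multiplication.
ℤ→ℚ-affine : ∀ n x r → ℤ→ℚ n ℚ.* ℤ→ℚ x ℚ.+ ℤ→ℚ r ≡ ℤ→ℚ (n * x + r)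
ℤ→ℚ-affine n x r = begin
  ℤ→ℚ n ℚ.* ℤ→ℚ x ℚ.+ ℤ→ℚ r
    ≡⟨ cong (ℚ._+ ℤ→ℚ r) (fromℚᵘ-homo-* (mkℚᵘ n 0) (mkℚᵘ x 0)) ⟩
  ℚ.fromℚᵘ (mkℚᵘ n 0 ℚᵘ.* mkℚᵘ x 0) ℚ.+ ℤ→ℚ r
    ≡⟨ fromℚᵘ-homo-+ (mkℚᵘ n 0 ℚᵘ.* mkℚᵘ x 0) (mkℚᵘ r 0) ⟩
  ℚ.fromℚᵘ (mkℚᵘ n 0 ℚᵘ.* mkℚᵘ x 0 ℚᵘ.+ mkℚᵘ r 0)
    ≡⟨ ℚ.fromℚᵘ-cong {mkℚᵘ n 0 ℚᵘ.* mkℚᵘ x 0 ℚᵘ.+ mkℚᵘ r 0} {mkℚᵘ (n * x + r) 0} (*≡* (crossMultiplied n x r)) ⟩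
  ℤ→ℚ (n * x + r) ∎
  where
  open ≡-Reasoning
  crossMultiplied : ∀ n x r → ((n * x) * + 1 + r * + 1) * + 1 ≡ (n * x + r) * (+ 1 * + 1)
  crossMultiplied = solve-∀

half-affine : ∀ n x r → ℤ→ℚ n ℚ.* (x / 2) ℚ.+ r / 2 ≡ (n * x + r) / 2
half-affine n x r = begin
  ℤ→ℚ n ℚ.* (x / 2) ℚ.+ r / 2
    ≡⟨ cong (ℚ._+ r / 2) (fromℚᵘ-homo-* (mkℚᵘ n 0) (mkℚᵘ x 1)) ⟩
  ℚ.fromℚᵘ (mkℚᵘ n 0 ℚᵘ.* mkℚᵘ x 1) ℚ.+ r / 2
    ≡⟨ fromℚᵘ-homo-+ (mkℚᵘ n 0 ℚᵘ.* mkℚᵘ x 1) (mkℚᵘ r 1) ⟩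
  ℚ.fromℚᵘ (mkℚᵘ n 0 ℚᵘ.* mkℚᵘ x 1 ℚᵘ.+ mkℚᵘ r 1)
    ≡⟨ ℚ.fromℚᵘ-cong {mkℚᵘ n 0 ℚᵘ.* mkℚᵘ x 1 ℚᵘ.+ mkℚᵘ r 1} {mkℚᵘ (n * x + r) 1} (*≡* (crossMultiplied n x r)) ⟩
  (n * x + r) / 2 ∎
  where
  open ≡-Reasoning
  crossMultiplied : ∀ n x r → ((n * x) * + 2 + r * + 2) * + 2 ≡ (n * x + r) * (+ 2 * + 2)
  crossMultiplied = solve-∀

/≡0⇒≡0 : ∀ x d .{{_ : ℕ.NonZero d}} → x / d ≡ ℚ.0ℚ → x ≡ 0ℤ
/≡0⇒≡0 x d eq =
  trans (sym (ℚ.↥-/ x d)) (trans (cong (λ q → ℚ.↥ q * ℤ.gcd x (+ d)) eq) (ℤ.*-zeroˡ (ℤ.gcd x (+ d))))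

coord : ∀ {m} → Elt m → Fin m → ℤ
coord c i = lookup (proj₁ c) i

C-upper : ∀ {m} (c : Elt m) {i j : Fin m} → i Fin.< j → C c i j ≡ ℤ→ℚ (col (proj₂ c) * (coord c i * coord c j))
C-upper (x , s) {i} {j} i<j with Fin.compare i j
... | Fin.less _ _    = refl
... | Fin.equal _     = ⊥-elim (ℕ.<-irrefl refl i<j)
... | Fin.greater _ j<i = ⊥-elim (ℕ.<-asym i<j (subst (ℕ._< Fin.toℕ i) (sym (Fin.toℕ-inject j<i)) (Fin.toℕ<n j<i)))

C-diagonal : ∀ {m} (c : Elt m) (i : Fin m) → C c i i ≡ (col (proj₂ c) * (coord c i * coord c i + coord c i)) / 2
C-diagonal c i = C-≡ c refl
  where
  C-≡ : ∀ {m} (c : Elt m) {i j : Fin m} → i ≡ j → C c i j ≡ (col (proj₂ c) * (coord c i * coord c i + coord c i)) / 2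
  C-≡ (x , s) {i} {j} i≡j with Fin.compare i j
  ... | Fin.less _ i<j    = ⊥-elim (ℕ.<-irrefl (trans (sym (Fin.toℕ-inject i<j)) (cong Fin.toℕ i≡j)) (Fin.toℕ<n i<j))
  ... | Fin.equal _       = refl
  ... | Fin.greater _ j<i = ⊥-elim (ℕ.<-irrefl (trans (sym (Fin.toℕ-inject j<i)) (cong Fin.toℕ (sym i≡j))) (Fin.toℕ<n j<i))

lcC-upper : ∀ {m} ns (cs : List (Elt m)) {i j} → i Fin.< j →
            lcC ns cs i j ≡ ℤ→ℚ (wsum ns cs (λ c → col (proj₂ c) * (coord c i * coord c j)))
lcC-upper []       cs       i<j = refl
lcC-upper (n ∷ ns) []       i<j = refl
lcC-upper (n ∷ ns) (c ∷ cs) i<j rewrite C-upper c i<j | lcC-upper ns cs i<j = ℤ→ℚ-affine n _ _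

lcC-diagonal : ∀ {m} ns (cs : List (Elt m)) i →
               lcC ns cs i i ≡ wsum ns cs (λ c → col (proj₂ c) * (coord c i * coord c i + coord c i)) / 2
lcC-diagonal []       cs       i = refl
lcC-diagonal (n ∷ ns) []       i = refl
lcC-diagonal (n ∷ ns) (c ∷ cs) i rewrite C-diagonal c i | lcC-diagonal ns cs i = half-affine n _ _

Factors : ℕ → Set
Factors m = List (Fin m × ℤ)

evalFactors : ∀ {m} → Factors m → ℤ^ m → ℤ
evalFactors []             x = 1ℤ
evalFactors ((j , t) ∷ fs) x = (lookup x j - t) * evalFactors fs x

separatingFactors : ∀ {m} (x : ℤ^ m) (ys : List (ℤ^ m)) →
  Σ (Factors m) λ fs → All (λ y → y ≢ x → evalFactors fs y ≡ 0ℤ) ys × evalFactors fs x ≢ 0ℤ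
separatingFactors x []       = [] , [] , λ ()
separatingFactors x (y ∷ ys) with separatingFactors x ys | Vec.≡-dec ℤ._≟_ y x
... | fs , vanish , fs[x]≢0 | yes refl = fs , (λ x≢x → ⊥-elim (x≢x refl)) ∷ vanish , fs[x]≢0
... | fs , vanish , fs[x]≢0 | no y≢x with differingCoordinate y x y≢x
...   | j , yⱼ≢xⱼ = (j , lookup y j) ∷ fs , (λ _ → vanish-y) ∷ All.map vanish-z vanish , nonvanish-x
  where
  vanish-y : (lookup y j - lookup y j) * evalFactors fs y ≡ 0ℤ
  vanish-y = trans (cong (_* evalFactors fs y) (ℤ.+-inverseʳ (lookup y j))) (ℤ.*-zeroˡ (evalFactors fs y))
  vanish-z : ∀ {z} → (z ≢ x → evalFactors fs z ≡ 0ℤ) → z ≢ x → (lookup z j - lookup y j) * evalFactors fs z ≡ 0ℤ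
  vanish-z {z} h z≢x = trans (cong ((lookup z j - lookup y j) *_) (h z≢x)) (ℤ.*-zeroʳ (lookup z j - lookup y j))
  nonvanish-x : (lookup x j - lookup y j) * evalFactors fs x ≢ 0ℤ
  nonvanish-x = *-≢0 (λ eq → yⱼ≢xⱼ (sym (ℤ.i-j≡0⇒i≡j _ _ eq))) fs[x]≢0

data Pick {A : Set} : List ℤ → List A → ℤ → A → Set where
  here  : ∀ {n ns x xs} → Pick (n ∷ ns) (x ∷ xs) n x
  there : ∀ {n ns x xs n′ x′} → Pick ns xs n′ x′ → Pick (n ∷ ns) (x ∷ xs) n′ x′

Pick⇒∈ : ∀ {A : Set} {ns} {xs : List A} {n x} → Pick ns xs n x → x ∈ xs
Pick⇒∈ here      = here refl
Pick⇒∈ (there p) = there (Pick⇒∈ p)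

pick-nonzero : ∀ {A : Set} {ns} {xs : List A} → length ns ≡ length xs → Any (_≢ 0ℤ) ns →
               ∃₂ λ n x → n ≢ 0ℤ × Pick ns xs n x
pick-nonzero {xs = x ∷ xs} len (here n≢0) = _ , x , n≢0 , here
pick-nonzero {xs = x ∷ xs} len (there any) with pick-nonzero (ℕ.suc-injective len) any
... | n , y , n≢0 , p = n , y , n≢0 , there p

wsum-pick : ∀ {A : Set} {ns} {xs : List A} {n x} f → Pick ns xs n x → Unique xs →
            All (λ y → y ≢ x → f y ≡ 0ℤ) xs → wsum ns xs f ≡ n * f x
wsum-pick {ns = n ∷ ns} {x = x} f here (x∉xs ∷ _) (_ ∷ vanish) =
  trans (cong (_+_ (n * f x)) (wsum-vanishing ns (All.zipWith (λ (x≢y , h) → h (x≢y ∘ sym)) (x∉xs , vanish))))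
        (ℤ.+-identityʳ (n * f x))
wsum-pick {ns = n₀ ∷ ns} {n = n} {x} f (there p) (y∉xs ∷ unique) (vanish-y ∷ vanish) = begin
  n₀ * f _ + wsum ns _ f ≡⟨ cong (λ a → n₀ * a + wsum ns _ f) (vanish-y (All.lookup y∉xs (Pick⇒∈ p))) ⟩
  n₀ * 0ℤ + wsum ns _ f ≡⟨ cong (_+ wsum ns _ f) (ℤ.*-zeroʳ n₀) ⟩
  0ℤ + wsum ns _ f      ≡⟨ ℤ.+-identityˡ _ ⟩
  wsum ns _ f           ≡⟨ wsum-pick f p unique vanish ⟩
  n * f x               ∎
  where open ≡-Reasoning

col≢0 : ∀ s → col s ≢ 0ℤ
col≢0 black ()
col≢0 red   ()

≢⇒proj₁≢ : ∀ {m} {c d : Elt m} → proj₂ d ≡ proj₂ c → d ≢ c → proj₁ d ≢ proj₁ c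
≢⇒proj₁≢ {c = _ , _} {d = _ , _} refl d≢c refl = d≢c refl

resonance-from-relation : ∀ {m} (cs : List (Elt m)) ns → length ns ≡ length cs →
  (∀ i → wsum ns cs (λ c → coord c i) ≡ 0ℤ) → NonzeroPoly (lcC ns cs) → AvoidableResonance cs
resonance-from-relation cs ns len rel nonzero =
  toVec ns len , lc≡0v , subst (λ xs → NonzeroPoly (lcC xs cs)) (sym (toList-toVec ns len)) nonzero
  where
  lc≡0v : lc (Vec.toList (toVec ns len)) (map proj₁ cs) ≡ 0v
  lc≡0v rewrite toList-toVec ns len =
    IsRelation⇒lc≡0v ns (map proj₁ cs) (λ i → trans (wsum-map ns cs proj₁ _) (rel i))

module Resonance {m} (σ : Color) (cs : List (Elt m)) (colours : All (λ c → proj₂ c ≡ σ) cs)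
                 (ns : List ℤ) (len : length ns ≡ length cs) (relation : IsRelation ns (map proj₁ cs)) where

  WeightedRelation : (Elt m → ℤ) → Set
  WeightedRelation g = ∀ i → wsum ns cs (λ c → g c * coord c i) ≡ 0ℤ

  WeightedQuadraticRelation : (Elt m → ℤ) → Set
  WeightedQuadraticRelation g = ∀ i j → wsum ns cs (λ c → g c * (coord c i * coord c j)) ≡ 0ℤ

  wsum-col : ∀ ns′ f → wsum ns′ cs (λ c → col (proj₂ c) * f c) ≡ col σ * wsum ns′ cs f
  wsum-col ns′ f =
    trans (wsum-congᴬ ns′ (All.map (λ {c} eq → cong (λ s → col s * f c) eq) colours)) (wsum-*ˡ ns′ cs (col σ) f)

  col-cancel : ∀ {z} → col σ * z ≡ 0ℤ → z ≡ 0ℤ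
  col-cancel = *-cancel-≢0 (col≢0 σ)

  module Reweighted (g : Elt m → ℤ) (weightedRelation : WeightedRelation g) where

    ns′ : List ℤ
    ns′ = reweight ns cs g

    relation′ : ∀ i → wsum ns′ cs (λ c → coord c i) ≡ 0ℤ
    relation′ i = trans (wsum-reweight ns cs g _) (weightedRelation i)

    -- The diagonal coefficient of Σ n′_c C(c) is σ/2 Σ n′_c (c_i² + c_i), whose linear part
    -- vanishes by relation′.
    zeroPoly⇒quadratic : (∀ i j → lcC ns′ cs i j ≡ ℚ.0ℚ) → WeightedQuadraticRelation g
    zeroPoly⇒quadratic zeroPoly i j = trans (sym (wsum-reweight ns cs g _)) (quadratic i j)
      where
      upper : ∀ {i j} → i Fin.< j → wsum ns′ cs (λ c → coord c i * coord c j) ≡ 0ℤ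
      upper {i} {j} i<j = col-cancel (trans (sym (wsum-col ns′ _))
        (/≡0⇒≡0 _ 1 (trans (sym (lcC-upper ns′ cs i<j)) (zeroPoly i j))))
      diagonal : ∀ i → wsum ns′ cs (λ c → coord c i * coord c i) ≡ 0ℤ
      diagonal i = begin
        wsum ns′ cs (λ c → coord c i * coord c i)
          ≡⟨ sym (trans (cong (_+_ (wsum ns′ cs (λ c → coord c i * coord c i))) (relation′ i)) (ℤ.+-identityʳ _)) ⟩
        wsum ns′ cs (λ c → coord c i * coord c i) + wsum ns′ cs (λ c → coord c i)
          ≡⟨ sym (wsum-+ ns′ cs _ _) ⟩
        wsum ns′ cs (λ c → coord c i * coord c i + coord c i)
          ≡⟨ col-cancel (trans (sym (wsum-col ns′ _)) (/≡0⇒≡0 _ 2 (trans (sym (lcC-diagonal ns′ cs i)) (zeroPoly i i)))) ⟩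
        0ℤ ∎
        where open ≡-Reasoning
      quadratic : ∀ i j → wsum ns′ cs (λ c → coord c i * coord c j) ≡ 0ℤ
      quadratic i j with Fin.<-cmp i j
      ... | tri< i<j _ _ = upper i<j
      ... | tri≈ _ refl _ = diagonal i
      ... | tri> _ _ j<i = trans (wsum-cong ns′ cs (λ c → ℤ.*-comm (coord c i) (coord c j))) (upper j<i)

    resonance⊎quadratic : AvoidableResonance cs ⊎ WeightedQuadraticRelation g
    resonance⊎quadratic with Fin.all? (λ i → Fin.all? (λ j → lcC ns′ cs i j ℚ.≟ ℚ.0ℚ))
    ... | yes zeroPoly = inj₂ (zeroPoly⇒quadratic zeroPoly)
    ... | no ¬zeroPoly with Fin.¬∀⟶∃¬ m _ (λ i → Fin.all? (λ j → lcC ns′ cs i j ℚ.≟ ℚ.0ℚ)) ¬zeroPoly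
    ...   | i , ¬zeroRow with Fin.¬∀⟶∃¬ m _ (λ j → lcC ns′ cs i j ℚ.≟ ℚ.0ℚ) ¬zeroRow
    ...     | j , nonzero =
      inj₁ (resonance-from-relation cs ns′ (length-reweight ns cs g len) relation′ (i , j , nonzero))

  relation-step : ∀ g j t → WeightedRelation g → WeightedQuadraticRelation g →
                  WeightedRelation (λ c → (coord c j - t) * g c)
  relation-step g j t rel quad i = begin
    wsum ns cs (λ c → (coord c j - t) * g c * coord c i)
      ≡⟨ wsum-cong ns cs (λ c → expand (coord c j) t (g c) (coord c i)) ⟩
    wsum ns cs (λ c → g c * (coord c j * coord c i) - t * (g c * coord c i))
      ≡⟨ wsum-linear ns cs (λ c → g c * (coord c j * coord c i)) t (λ c → g c * coord c i) ⟩
    wsum ns cs (λ c → g c * (coord c j * coord c i)) - t * wsum ns cs (λ c → g c * coord c i)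
      ≡⟨ cong₂ (λ a b → a - t * b) (quad j i) (rel i) ⟩
    0ℤ - t * 0ℤ
      ≡⟨ vanish t ⟩
    0ℤ ∎
    where
    open ≡-Reasoning
    expand : ∀ a t p b → (a - t) * p * b ≡ p * (a * b) - t * (p * b)
    expand = solve-∀
    vanish : ∀ t → 0ℤ - t * 0ℤ ≡ 0ℤ
    vanish = solve-∀

  resonance⊎relation : ∀ fs → AvoidableResonance cs ⊎ WeightedRelation (λ c → evalFactors fs (proj₁ c))
  resonance⊎relation [] = inj₂ λ i →
    trans (wsum-cong ns cs (λ c → ℤ.*-identityˡ (coord c i))) (trans (sym (wsum-map ns cs proj₁ _)) (relation i))
  resonance⊎relation ((j , t) ∷ fs) with resonance⊎relation fs
  ... | inj₁ resonance = inj₁ resonance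
  ... | inj₂ rel with Reweighted.resonance⊎quadratic (λ c → evalFactors fs (proj₁ c)) rel
  ...   | inj₁ resonance = inj₁ resonance
  ...   | inj₂ quad = inj₂ (relation-step (λ c → evalFactors fs (proj₁ c)) j t rel quad)

  resonance : Unique cs → All (λ c → ∃ λ i → coord c i ≢ 0ℤ) cs → Any (_≢ 0ℤ) ns → AvoidableResonance cs
  resonance unique nonzeroVectors nonzeroCoefficient with pick-nonzero len nonzeroCoefficient
  ... | n , c , n≢0 , p with separatingFactors (proj₁ c) (map proj₁ cs)
  ...   | fs , vanish , P[c]≢0 with resonance⊎relation fs
  ...     | inj₁ res = res
  ...     | inj₂ rel = ⊥-elim (nonzero (trans (sym (wsum-pick Paᵢ p unique vanish′)) (rel i)))
    where
    c∈cs : c ∈ cs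
    c∈cs = Pick⇒∈ p
    i : Fin m
    i = proj₁ (All.lookup nonzeroVectors c∈cs)
    Paᵢ : Elt m → ℤ
    Paᵢ d = evalFactors fs (proj₁ d) * coord d i
    vanish′ : All (λ d → d ≢ c → Paᵢ d ≡ 0ℤ) cs
    vanish′ = All.zipWith vanishes (All.map⁻ vanish , colours)
      where
      vanishes : ∀ {d} → (proj₁ d ≢ proj₁ c → evalFactors fs (proj₁ d) ≡ 0ℤ) × proj₂ d ≡ σ → d ≢ c → Paᵢ d ≡ 0ℤ
      vanishes {d} (h , d-colour) d≢c =
        trans (cong (_* coord d i) (h (≢⇒proj₁≢ (trans d-colour (sym (All.lookup colours c∈cs))) d≢c)))
              (ℤ.*-zeroˡ (coord d i))
    nonzero : n * Paᵢ c ≢ 0ℤ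
    nonzero = *-≢0 n≢0 (*-≢0 P[c]≢0 (proj₂ (All.lookup nonzeroVectors c∈cs)))

LinDependent⇒AvoidableResonance : ∀ {m} σ (cs : List (Elt m)) → All (λ c → proj₂ c ≡ σ) cs →
  All (λ c → ∃ λ i → coord c i ≢ 0ℤ) cs → Unique cs → LinDependent (map proj₁ cs) → AvoidableResonance cs
LinDependent⇒AvoidableResonance σ cs colours nonzero unique (ns , len , rel , nonzeroCoefficient) =
  Resonance.resonance σ cs colours ns (trans len (List.length-map proj₁ cs)) rel unique nonzero nonzeroCoefficient

isZeroVec-0v : ∀ m → isZeroVec (0v {m}) ≡ true
isZeroVec-0v zero    = refl
isZeroVec-0v (suc m) = isZeroVec-0v m

η-0v : ∀ m → η (0v {m}) ≡ 0ℤ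
η-0v zero    = refl
η-0v (suc m) = trans (ℤ.+-identityˡ _) (η-0v m)

-- isColoredNonzero only excludes the black zero; a red zero is ruled out by η a = σ − 1 = −2.
0v-not-coloredNonzero : ∀ {m} σ τ → T (isColoredNonzero σ (0v {m} , τ)) → ¬ InG2 (0v {m} , τ)
0v-not-coloredNonzero {m} black black marked _ rewrite isZeroVec-0v m = marked
0v-not-coloredNonzero {m} red   red   _ η≡-2 with trans (sym (η-0v m)) η≡-2
... | ()

coloredNonzero⇒colour : ∀ {m} σ (c : Elt m) → T (isColoredNonzero σ c) → proj₂ c ≡ σ
coloredNonzero⇒colour black (_ , black) _ = refl
coloredNonzero⇒colour red   (_ , red)   _ = refl

coloredNonzero⇒nonzeroCoordinate : ∀ {m} σ (c : Elt m) → T (isColoredNonzero σ c) → InG2 c →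
                                   ∃ λ i → coord c i ≢ 0ℤ
coloredNonzero⇒nonzeroCoordinate {m} σ (x , τ) marked inG2 with zero⊎nonzeroCoordinate x
... | inj₂ nonzero = nonzero
... | inj₁ allZero with lookup-ext x 0v (λ i → trans (allZero i) (sym (lookup-0v i)))
...   | refl = ⊥-elim (0v-not-coloredNonzero {m} σ τ marked inG2)

verts-marked : ∀ {m} σ (A : List (Elt m)) → All (T ∘ isColoredNonzero σ) (verts σ A)
verts-marked σ A = All.all-filter (T? ∘ isColoredNonzero σ) A

verts-colour : ∀ {m} σ (A : List (Elt m)) → All (λ c → proj₂ c ≡ σ) (verts σ A)
verts-colour σ A = All.map (λ {c} → coloredNonzero⇒colour σ c) (verts-marked σ A)

verts-nonzero : ∀ {m} σ (A : List (Elt m)) → All InG2 A → All (λ c → ∃ λ i → coord c i ≢ 0ℤ) (verts σ A)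
verts-nonzero σ A inG2 = All.zipWith (λ {c} (marked , inG2) → coloredNonzero⇒nonzeroCoordinate σ c marked inG2)
  (verts-marked σ A , All.filter⁺ (T? ∘ isColoredNonzero σ) inG2)

verts-unique : ∀ {m} σ (A : List (Elt m)) → Unique A → Unique (verts σ A)
verts-unique σ A = Unique.filter⁺ (T? ∘ isColoredNonzero σ)

mainTheorem8 : ∀ {m : ℕ} (n : ℕ) → 1 ℕ.≤ n →
    (A : List (Elt m)) → CombGraph A → length A ℕ.≤ 2 ℕ.* n ℕ.+ 2 →
    (σ : Color) (k : ℕ) → HasRank (map proj₁ (verts σ A)) k →
    (length (verts σ A) ≡ k) ⊎ AvoidableResonance (verts σ A)
mainTheorem8 {m} _ _ A graph _ σ k rank with independent⊎dependent m (map proj₁ (verts σ A))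
... | inj₁ (independent , _) =
  inj₁ (trans (sym (List.length-map proj₁ (verts σ A))) (LinIndependent⇒length≡rank independent rank))
... | inj₂ dependent =
  inj₂ (LinDependent⇒AvoidableResonance σ (verts σ A) (verts-colour σ A)
          (verts-nonzero σ A (CombGraph.inG2 graph)) (verts-unique σ A (CombGraph.distinct graph)) dependent)
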